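{- Suppose $G$ is a group and $\phi:G\to\mathbb{Z}$ is a homomorphism. Let $(W,B)$ be a connected latin bitrade such that $W$ is embedded in $G$ (i.e. its rows, columns and symbols are elements of $G$ and $rc=s$ for all $(r,c,s)\in W$). Then $W$ embeds in the kernel of $\phi$.
   Context: A partial latin square (PLS) is a finite set of triples (row, column, symbol) such that any two distinct triples agree in at most one coordinate. A latin bitrade is a pair $(W,B)$ of non-empty PLS such that for each $(r,c,s)\in W$ (respectively $B$) there exist unique $r'\ne r$, $c'\ne c$, $s'\ne s$ with $(r',c,s),(r,c',s),(r,c,s')\in B$ (respectively $W$). It is connected if there are no latin bitrades $(W',B')$, $(W'',B'')$ with $W'\cap W''=\emptyset$, $W=W'\cup W''$, $B=B'\cup B''$. A PLS $P$ with row, column, symbol sets $R,C,S$ embeds in a group $H$ if there are injections $f:R\to H$, $h:C\to H$, $k:S\to H$ with $f(r)h(c)=k(s)$ for all $(r,c,s)\in P$. -}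

module Defs where

open import Level using (Level; _⊔_)
open import Data.Product using (Σ; ∃; _×_; _,_)
open import Data.Sum using (_⊎_)
open import Data.Empty using (⊥)
open import Data.Unit.Polymorphic using (⊤)
open import Data.List using (List)
open import Data.List.Membership.Propositional using (_∈_)
open import Relation.Nullary using (¬_)
open import Relation.Binary.PropositionalEquality using (_≡_; _≢_)
open import Data.Integer using (ℤ; +_)
open import Data.Integer.Properties using (+-0-abelianGroup)
open import Algebra.Bundles using (Group; AbelianGroup)
open import Algebra.Morphism.Structures using (module GroupMorphisms)

private
  variable
    a c ℓ p : Level

-- A triple (row , column , symbol) with labels drawn from a type X.
Triple : Set a → Set a
Triple X = X × X × X

-- A finite set of triples is represented by a list (membership is all that matters).
TSet : Set a → Set a
TSet X = List (Triple X)

AgreeAtMostOne : {X : Set a} → Triple X → Triple X → Set a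
AgreeAtMostOne (r , c , s) (r' , c' , s') =
  ¬ (r ≡ r' × c ≡ c') × ¬ (r ≡ r' × s ≡ s') × ¬ (c ≡ c' × s ≡ s')

IsPLS : {X : Set a} → TSet X → Set a
IsPLS P = ∀ {t t'} → t ∈ P → t' ∈ P → t ≢ t' → AgreeAtMostOne t t'

NonEmpty : {X : Set a} → TSet X → Set a
NonEmpty {X = X} P = ∃ λ (t : Triple X) → t ∈ P

∃!≢ : {X : Set a} → X → (X → Set a) → Set a
∃!≢ {X = X} x₀ Q = Σ X λ x → x ≢ x₀ × Q x × (∀ y → y ≢ x₀ → Q y → y ≡ x)

Mates : {X : Set a} → TSet X → TSet X → Set a
Mates P Q = ∀ {r c s} → (r , c , s) ∈ P →
    ∃!≢ r (λ r' → (r' , c , s) ∈ Q)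
  × ∃!≢ c (λ c' → (r , c' , s) ∈ Q)
  × ∃!≢ s (λ s' → (r , c , s') ∈ Q)

IsBitrade : {X : Set a} → TSet X → TSet X → Set a
IsBitrade W B = IsPLS W × IsPLS B × NonEmpty W × NonEmpty B × Mates W B × Mates B W

Disjoint : {X : Set a} → TSet X → TSet X → Set a
Disjoint P Q = ∀ {t} → t ∈ P → t ∈ Q → ⊥

IsUnion : {X : Set a} → TSet X → TSet X → TSet X → Set a
IsUnion P P' P'' = ∀ t → (t ∈ P → t ∈ P' ⊎ t ∈ P'') × (t ∈ P' ⊎ t ∈ P'' → t ∈ P)

IsConnected : {X : Set a} → TSet X → TSet X → Set a
IsConnected {X = X} W B =
  ¬ (Σ (TSet X) λ W' → Σ (TSet X) λ B' → Σ (TSet X) λ W'' → Σ (TSet X) λ B'' →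
       IsBitrade W' B' × IsBitrade W'' B'' × Disjoint W' W''
     × IsUnion W W' W'' × IsUnion B B' B'')

IsConnectedBitrade : {X : Set a} → TSet X → TSet X → Set a
IsConnectedBitrade W B = IsBitrade W B × IsConnected W B

EmbedsIn : {X : Set a} (G : Group c ℓ) → (Group.Carrier G → Set p) → TSet X → Set (a ⊔ c ⊔ ℓ ⊔ p)
EmbedsIn {X = X} G H P =
  Σ (X → Carrier) λ f → Σ (X → Carrier) λ h → Σ (X → Carrier) λ k →
      (∀ {r c s} → (r , c , s) ∈ P → H (f r) × H (h c) × H (k s))
    × (∀ {r c s r' c' s'} → (r , c , s) ∈ P → (r' , c' , s') ∈ P → f r ≈ f r' → r ≡ r')
    × (∀ {r c s r' c' s'} → (r , c , s) ∈ P → (r' , c' , s') ∈ P → h c ≈ h c' → c ≡ c')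
    × (∀ {r c s r' c' s'} → (r , c , s) ∈ P → (r' , c' , s') ∈ P → k s ≈ k s' → s ≡ s')
    × (∀ {r c s} → (r , c , s) ∈ P → (f r ∙ h c) ≈ k s)
  where open Group G

EmbedsInGroup : {X : Set a} (G : Group c ℓ) → TSet X → Set (a ⊔ c ⊔ ℓ)
EmbedsInGroup {a = a} G P = EmbedsIn {p = Level.zero} G (λ _ → ⊤) P

ℤ+ : Group Level.zero Level.zero
ℤ+ = AbelianGroup.group +-0-abelianGroup

IsHomToℤ : (G : Group c ℓ) → (Group.Carrier G → ℤ) → Set (c ⊔ ℓ)
IsHomToℤ G φ = GroupMorphisms.IsGroupHomomorphism (Group.rawGroup G) (Group.rawGroup ℤ+) φ

Ker : {G : Group c ℓ} → (Group.Carrier G → ℤ) → Group.Carrier G → Set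
Ker φ g = φ g ≡ + 0

-- The integers α r = φ (f r), β c = φ (h c), γ s = φ (k s) satisfy
-- α r + β c = γ s on W.  The same relation holds on B: for each coordinate the
-- mate relation is a bijection between W and B fixing the other two coordinates,
-- so every sum over B of a function ignoring one coordinate equals the sum over W;
-- expanding the square of the defect d = α r + β c - γ s into such sums gives
-- Σ_B d² = Σ_W d² = 0 (labelling-on-mates).  Hence α and β do not change between
-- a triple of W and its mates, and connectedness makes them constant on W, since a
-- non-trivial level set would split the bitrade (mate-invariant-constant).
-- Translating the embedding so that one triple of W goes to (1, 1, 1) then places
-- every label in ker φ.

module Submission where

open import Defs
open import Level using (Level; _⊔_)
open import Data.Integer using (ℤ)
open import Algebra.Bundles using (Group)

open import Function using (_∘_; flip)
open import Data.Product using (Σ; _×_; _,_; proj₁; proj₂)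
open import Data.Sum using (_⊎_; inj₁; inj₂; reduce)
open import Data.Empty using (⊥-elim)
open import Data.Nat as ℕ using (ℕ)
open import Data.Integer using (+_; +[1+_]; -[1+_]; 0ℤ; _+_; _-_; _*_; ∣_∣; _≟_)
import Data.Integer.Properties as ℤP
open import Data.Integer.Solver using (module +-*-Solver)
open import Data.List using (List; []; _∷_; filter)
open import Data.List.Membership.Propositional using (_∈_; _∉_)
open import Data.List.Membership.Propositional.Properties using (∈-filter⁺; ∈-filter⁻)
open import Data.List.Relation.Unary.Any using (here; there; _─_)
import Data.List.Relation.Unary.All as All
open import Data.List.Relation.Unary.All.Properties using (¬Any⇒All¬; ─⁺)
open import Data.List.Relation.Unary.AllPairs using (_∷_)
open import Data.List.Relation.Unary.Unique.Propositional using (Unique; [])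
open import Effect.Monad using (RawMonad)
open import Algebra.Morphism.Structures using (module GroupMorphisms)
open import Algebra.Properties.Group using (∙-cancelˡ; ∙-cancelʳ; \\-leftDividesʳ)
import Relation.Binary.Reasoning.Setoid as SetoidReasoning
open import Relation.Unary using (Pred; Decidable)
open import Relation.Nullary using (¬_; Dec; yes; no; ¬?)
open import Relation.Nullary.Negation using (¬¬-Monad; contradiction)
open import Relation.Nullary.Decidable using (¬¬-excluded-middle; decidable-stable)
open import Relation.Binary.Definitions using (DecidableEquality)
open import Relation.Binary.PropositionalEquality hiding ([_])

private
  variable
    a q : Level

module _ {A : Set a} where

  SameMembers : List A → List A → Set a
  SameMembers L L' = (∀ {x} → x ∈ L → x ∈ L') × (∀ {x} → x ∈ L' → x ∈ L)

  prepend-dedup : ∀ {x xs L'} → Unique L' → SameMembers xs L' → Dec (x ∈ L') →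
                  Σ (List A) λ L'' → Unique L'' × SameMembers (x ∷ xs) L''
  prepend-dedup {L' = L'} u (to , from) (yes x∈L') =
    L' , u , (λ { (here refl) → x∈L' ; (there p) → to p }) , there ∘ from
  prepend-dedup {x = x} {L' = L'} u (to , from) (no x∉L') =
    x ∷ L' , ¬Any⇒All¬ L' x∉L' ∷ u ,
    (λ { (here refl) → here refl ; (there p) → there (to p) }) ,
    (λ { (here refl) → here refl ; (there p) → there (from p) })

  -- Every list has a duplicate-free copy.  Without decidable equality on A
  -- this holds only up to double negation, which suffices for proving
  -- decidable (hence stable) facts.
  deduplicate : (L : List A) → ¬ ¬ (Σ (List A) λ L' → Unique L' × SameMembers L L')
  deduplicate [] = contradiction ([] , [] , (λ ()) , (λ ()))
  deduplicate (x ∷ xs) = do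
      (L' , u , same) ← deduplicate xs
      x∈L'? ← ¬¬-excluded-middle
      pure (prepend-dedup u same x∈L'?)
    where open RawMonad (¬¬-Monad {a})

  ∑ : List A → (A → ℤ) → ℤ
  ∑ []       g = 0ℤ
  ∑ (x ∷ xs) g = g x + ∑ xs g

  ∑-cong : (L : List A) {g g' : A → ℤ} → (∀ {x} → x ∈ L → g x ≡ g' x) → ∑ L g ≡ ∑ L g'
  ∑-cong []       eq = refl
  ∑-cong (x ∷ xs) eq = cong₂ _+_ (eq (here refl)) (∑-cong xs (eq ∘ there))

  ∑-+ : (L : List A) (g g' : A → ℤ) → ∑ L (λ x → g x + g' x) ≡ ∑ L g + ∑ L g'
  ∑-+ []       g g' = refl
  ∑-+ (x ∷ xs) g g' rewrite ∑-+ xs g g' =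
    solve 4 (λ u v U V → (u :+ v) :+ (U :+ V) := (u :+ U) :+ (v :+ V)) refl
      (g x) (g' x) (∑ xs g) (∑ xs g')
    where open +-*-Solver

  ∑-─ : (L : List A) {x : A} (p : x ∈ L) (g : A → ℤ) → ∑ L g ≡ g x + ∑ (L ─ p) g
  ∑-─ (y ∷ ys) (here refl) g = refl
  ∑-─ (y ∷ ys) {x} (there p) g rewrite ∑-─ ys p g =
    solve 3 (λ u v w → u :+ (v :+ w) := v :+ (u :+ w)) refl (g y) (g x) (∑ (ys ─ p) g)
    where open +-*-Solver

  ∑-square-expand : (L : List A) (u v : A → ℤ) →
    ∑ L (λ x → (u x - v x) * (u x - v x))
      ≡ ∑ L (λ x → u x * u x) - + 2 * ∑ L (λ x → u x * v x) + ∑ L (λ x → v x * v x)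
  ∑-square-expand []       u v = refl
  ∑-square-expand (x ∷ xs) u v rewrite ∑-square-expand xs u v =
    solve 5 (λ p q U M V →
        (p :- q) :* (p :- q) :+ (U :- con (+ 2) :* M :+ V)
          := (p :* p :+ U) :- con (+ 2) :* (p :* q :+ M) :+ (q :* q :+ V))
      refl (u x) (v x) (∑ xs (λ x → u x * u x)) (∑ xs (λ x → u x * v x)) (∑ xs (λ x → v x * v x))
    where open +-*-Solver

  square-natural : ∀ i → i * i ≡ + (∣ i ∣ ℕ.* ∣ i ∣)
  square-natural (+ 0)    = refl
  square-natural +[1+ n ] = refl
  square-natural -[1+ n ] = refl

  ∑-squares-natural : (L : List A) (g : A → ℤ) → Σ ℕ λ n → ∑ L (λ x → g x * g x) ≡ + n
  ∑-squares-natural []       g = 0 , refl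
  ∑-squares-natural (x ∷ xs) g =
    let (n , rest) = ∑-squares-natural xs g in
    ∣ g x ∣ ℕ.* ∣ g x ∣ ℕ.+ n , cong₂ _+_ (square-natural (g x)) rest

  naturals-sum-zero : ∀ m n → + m + + n ≡ 0ℤ → + m ≡ 0ℤ × + n ≡ 0ℤ
  naturals-sum-zero 0 0 _ = refl , refl

  ∑-squares-zero : (L : List A) (g : A → ℤ) → ∑ L (λ x → g x * g x) ≡ 0ℤ →
                   ∀ {x} → x ∈ L → g x ≡ 0ℤ
  ∑-squares-zero (y ∷ ys) g total p
    with n , rest ← ∑-squares-natural ys g
    with head≡0 , rest≡0 ← naturals-sum-zero _ n (trans (sym (cong₂ _+_ (square-natural (g y)) rest)) total)
       | p
  ... | here refl = reduce (ℤP.i*j≡0⇒i≡0∨j≡0 (g y) (trans (square-natural (g y)) head≡0))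
  ... | there q   = ∑-squares-zero ys g (trans rest rest≡0) q

  ∈-─⁻ : (L : List A) {x y : A} (p : x ∈ L) → y ∈ (L ─ p) → y ∈ L
  ∈-─⁻ (z ∷ zs) (here _)  q         = there q
  ∈-─⁻ (z ∷ zs) (there p) (here eq) = here eq
  ∈-─⁻ (z ∷ zs) (there p) (there q) = there (∈-─⁻ zs p q)

  ∈-─⁺ : (L : List A) {x y : A} (p : x ∈ L) → y ∈ L → y ≢ x → y ∈ (L ─ p)
  ∈-─⁺ (z ∷ zs) (here refl) (here refl) y≢x = ⊥-elim (y≢x refl)
  ∈-─⁺ (z ∷ zs) (here refl) (there q)   y≢x = q
  ∈-─⁺ (z ∷ zs) (there p)   (here eq)   y≢x = here eq
  ∈-─⁺ (z ∷ zs) (there p)   (there q)   y≢x = there (∈-─⁺ zs p q y≢x)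

  Unique-─ : (L : List A) {x : A} (p : x ∈ L) → Unique L → Unique (L ─ p)
  Unique-─ (z ∷ zs) (here _)  (_ ∷ u)   = u
  Unique-─ (z ∷ zs) (there p) (z∉ ∷ u) = ─⁺ p z∉ ∷ Unique-─ zs p u

  ∉-─ : (L : List A) {x : A} (p : x ∈ L) → Unique L → x ∉ (L ─ p)
  ∉-─ (z ∷ zs) (here refl) (z∉ ∷ u) q         = All.lookup z∉ q refl
  ∉-─ (z ∷ zs) (there p)   (z∉ ∷ u) (here refl) = All.lookup z∉ p refl
  ∉-─ (z ∷ zs) (there p)   (z∉ ∷ u) (there q)   = ∉-─ zs p u q

module _ {A : Set a} where

  UniquePartners : (A → A → Set q) → List A → List A → Set (a ⊔ q)
  UniquePartners R P Q =
    ∀ {x} → x ∈ P → Σ A λ y → y ∈ Q × R x y × (∀ {y'} → y' ∈ Q → R x y' → y' ≡ y)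

  Matching : (A → A → Set q) → List A → List A → Set (a ⊔ q)
  Matching R P Q = UniquePartners R P Q × UniquePartners (flip R) Q P

  matching-resp : ∀ {R : A → A → Set q} {P P' Q Q'} → SameMembers P P' → SameMembers Q Q' →
                  Matching R P Q → Matching R P' Q'
  matching-resp sameP sameQ (forth , back) = transfer sameP sameQ forth , transfer sameQ sameP back
    where
      transfer : ∀ {S : A → A → Set q} {P P' Q Q'} → SameMembers P P' → SameMembers Q Q' →
                 UniquePartners S P Q → UniquePartners S P' Q'
      transfer (_ , fromP) (toQ , fromQ) partners x∈P' =
        let (y , y∈Q , xSy , unique) = partners (fromP x∈P') in
        y , toQ y∈Q , xSy , unique ∘ fromQ

  ∑-matching : ∀ {R : A → A → Set q} (g : A → ℤ) → (∀ {x y} → R x y → g x ≡ g y) →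
               (P Q : List A) → Unique P → Unique Q → Matching R P Q → ∑ P g ≡ ∑ Q g
  ∑-matching g g-resp [] []      _ _ _ = refl
  ∑-matching g g-resp [] (y ∷ Q) _ _ (_ , back) with () ← proj₁ (proj₂ (back (here refl)))
  ∑-matching {R = R} g g-resp (x ∷ P) Q (x∉P ∷ uP) uQ (forth , back)
    with y , y∈Q , xRy , y-unique ← forth (here refl) = begin
      g x + ∑ P g          ≡⟨ cong₂ _+_ (g-resp xRy) (∑-matching g g-resp P (Q ─ y∈Q) uP uQ' (forth' , back')) ⟩
      g y + ∑ (Q ─ y∈Q) g  ≡⟨ ∑-─ Q y∈Q g ⟨
      ∑ Q g                ∎
    where
      open ≡-Reasoning
      uQ' : Unique (Q ─ y∈Q)
      uQ' = Unique-─ Q y∈Q uQ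
      -- the partners of the remaining entries of P avoid y, since y is already x's partner
      forth' : UniquePartners R P (Q ─ y∈Q)
      forth' x'∈P =
        let (y' , y'∈Q , x'Ry' , unique) = forth (there x'∈P)
            (_ , _ , _ , y-partner-unique) = back y∈Q
            y'≢y : y' ≢ y
            y'≢y y'≡y = All.lookup x∉P x'∈P
              (trans (y-partner-unique (here refl) xRy)
                     (sym (y-partner-unique (there x'∈P) (subst (R _) y'≡y x'Ry'))))
        in y' , ∈-─⁺ Q y∈Q y'∈Q y'≢y , x'Ry' , unique ∘ ∈-─⁻ Q y∈Q
      -- the partner of a remaining entry of Q is not x, since x's partner y was removed
      back' : UniquePartners (flip R) (Q ─ y∈Q) P
      back' {y'} y'∈Q' with back (∈-─⁻ Q y∈Q y'∈Q')
      ... | x' , there x'∈P , y'Rx' , unique = x' , x'∈P , y'Rx' , unique ∘ there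
      ... | x' , here refl , xRy' , _ = ⊥-elim (∉-─ Q y∈Q uQ
              (subst (_∈ (Q ─ y∈Q)) (y-unique (∈-─⁻ Q y∈Q y'∈Q') xRy') y'∈Q'))

data Axis : Set where
  row column symbol : Axis

module _ {X : Set a} where

  infix  8 _at_
  infixl 9 _[_≔_]

  _at_ : Triple X → Axis → X
  (r , c , s) at row    = r
  (r , c , s) at column = c
  (r , c , s) at symbol = s

  _[_≔_] : Triple X → Axis → X → Triple X
  (r , c , s) [ row    ≔ x ] = x , c , s
  (r , c , s) [ column ≔ x ] = r , x , s
  (r , c , s) [ symbol ≔ x ] = r , c , x

  at-≔ : ∀ t ax x → t [ ax ≔ x ] at ax ≡ x
  at-≔ t row    x = refl
  at-≔ t column x = refl
  at-≔ t symbol x = refl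

  ≔-restore : ∀ t ax x → t [ ax ≔ x ] [ ax ≔ t at ax ] ≡ t
  ≔-restore t row    x = refl
  ≔-restore t column x = refl
  ≔-restore t symbol x = refl

  MatesAlong : Axis → TSet X → TSet X → Set a
  MatesAlong ax P Q = ∀ {t} → t ∈ P → ∃!≢ (t at ax) (λ x → t [ ax ≔ x ] ∈ Q)

  mates-along : ∀ {P Q} → Mates P Q → ∀ ax → MatesAlong ax P Q
  mates-along m row    {r , c , s} p = proj₁ (m p)
  mates-along m column {r , c , s} p = proj₁ (proj₂ (m p))
  mates-along m symbol {r , c , s} p = proj₂ (proj₂ (m p))

  mates-from-along : ∀ {P Q} → (∀ ax → MatesAlong ax P Q) → Mates P Q
  mates-from-along m p = m row p , m column p , m symbol p

  Differ : Axis → Triple X → Triple X → Set a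
  Differ ax t t' = Σ X λ x → x ≢ t at ax × t' ≡ t [ ax ≔ x ]

  Differ-sym : ∀ {ax t t'} → Differ ax t t' → Differ ax t' t
  Differ-sym {ax} {t} (x , x≢ , refl) =
    t at ax , (λ eq → x≢ (trans (sym (at-≔ t ax x)) (sym eq))) , sym (≔-restore t ax x)

  mate-partners : ∀ {ax P Q} → MatesAlong ax P Q → UniquePartners (Differ ax) P Q
  mate-partners {ax} m {t} t∈P =
    let (x , x≢ , t[x]∈Q , unique) = m t∈P in
    t [ ax ≔ x ] , t[x]∈Q , (x , x≢ , refl) ,
    λ { t'∈Q (x' , x'≢ , refl) → cong (t [ ax ≔_]) (unique x' x'≢ t'∈Q) }

  mate-matching : ∀ {ax P Q} → MatesAlong ax P Q → MatesAlong ax Q P → Matching (Differ ax) P Q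
  mate-matching mPQ mQP = mate-partners mPQ , flip-partners (mate-partners mQP)
    where
      flip-partners : ∀ {ax P Q} → UniquePartners (Differ ax) Q P → UniquePartners (flip (Differ ax)) Q P
      flip-partners partners y∈Q =
        let (x , x∈P , yDx , unique) = partners y∈Q in
        x , x∈P , Differ-sym yDx , λ x'∈P x'Dy → unique x'∈P (Differ-sym x'Dy)

  ∑-mates : ∀ ax (g : Triple X → ℤ) → (∀ t x → g (t [ ax ≔ x ]) ≡ g t) →
            ∀ {P Q} → MatesAlong ax P Q → MatesAlong ax Q P →
            ∀ {P₀ Q₀} → Unique P₀ → Unique Q₀ → SameMembers P P₀ → SameMembers Q Q₀ →
            ∑ P₀ g ≡ ∑ Q₀ g
  ∑-mates ax g ignores mPQ mQP {P₀} {Q₀} uP uQ sameP sameQ =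
    ∑-matching g (λ { (x , _ , refl) → sym (ignores _ x) }) P₀ Q₀ uP uQ
      (matching-resp sameP sameQ (mate-matching mPQ mQP))

-- Writing
-- d = α r + β c - γ s, the sum of d² over B expands into sums of functions each
-- ignoring one coordinate; these agree with the sums over W, where d vanishes,
-- so the sum over B is zero and hence so is every term.
labelling-on-mates : {X : Set a} {W B : TSet X} → Mates W B → Mates B W →
  (α β γ : X → ℤ) → (∀ {r c s} → (r , c , s) ∈ W → α r + β c ≡ γ s) →
  ∀ {r c s} → (r , c , s) ∈ B → α r + β c ≡ γ s
labelling-on-mates {X = X} {W} {B} mWB mBW α β γ on-W {r} {c} {s} t∈B =
  decidable-stable (α r + β c ≟ γ s) λ fails →
    deduplicate W λ (W₀ , uW , sameW) →
    deduplicate B λ (B₀ , uB , sameB) →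
    fails (ℤP.i-j≡0⇒i≡j _ _
      (∑-squares-zero B₀ defect (defect-vanishes uW uB sameW sameB) (proj₁ sameB t∈B)))
  where
    αₜ βₜ γₜ defect : Triple X → ℤ
    αₜ t = α (t at row)
    βₜ t = β (t at column)
    γₜ t = γ (t at symbol)
    defect t = αₜ t + βₜ t - γₜ t

    on-W′ : ∀ {t} → t ∈ W → αₜ t + βₜ t ≡ γₜ t
    on-W′ {r , c , s} = on-W

    split : ∀ L → ∑ L (λ t → (αₜ t + βₜ t) * γₜ t) ≡ ∑ L (λ t → αₜ t * γₜ t) + ∑ L (λ t → βₜ t * γₜ t)
    split L = trans (∑-cong L (λ {t} _ → ℤP.*-distribʳ-+ (γₜ t) (αₜ t) (βₜ t))) (∑-+ L _ _)

    module _ {W₀ B₀ : TSet X} (uW : Unique W₀) (uB : Unique B₀)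
             (sameW : SameMembers W W₀) (sameB : SameMembers B B₀) where

      transfer : ∀ ax (g : Triple X → ℤ) → (∀ t x → g (t [ ax ≔ x ]) ≡ g t) → ∑ B₀ g ≡ ∑ W₀ g
      transfer ax g ignores =
        sym (∑-mates ax g ignores (mates-along mWB ax) (mates-along mBW ax) uW uB sameW sameB)

      S : ℤ
      S = ∑ W₀ (λ t → γₜ t * γₜ t)

      on-W₀ : ∀ {t} → t ∈ W₀ → αₜ t + βₜ t ≡ γₜ t
      on-W₀ = on-W′ ∘ proj₂ sameW

      square-sum : ∑ B₀ (λ t → (αₜ t + βₜ t) * (αₜ t + βₜ t)) ≡ S
      square-sum = trans (transfer symbol _ (λ _ _ → refl))
                         (∑-cong W₀ λ t∈W₀ → cong₂ _*_ (on-W₀ t∈W₀) (on-W₀ t∈W₀))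

      cross-sum : ∑ B₀ (λ t → (αₜ t + βₜ t) * γₜ t) ≡ S
      cross-sum = begin
        ∑ B₀ (λ t → (αₜ t + βₜ t) * γₜ t)
          ≡⟨ split B₀ ⟩
        ∑ B₀ (λ t → αₜ t * γₜ t) + ∑ B₀ (λ t → βₜ t * γₜ t)
          ≡⟨ cong₂ _+_ (transfer column _ (λ _ _ → refl)) (transfer row _ (λ _ _ → refl)) ⟩
        ∑ W₀ (λ t → αₜ t * γₜ t) + ∑ W₀ (λ t → βₜ t * γₜ t)
          ≡⟨ split W₀ ⟨
        ∑ W₀ (λ t → (αₜ t + βₜ t) * γₜ t)
          ≡⟨ ∑-cong W₀ (λ t∈W₀ → cong (_* _) (on-W₀ t∈W₀)) ⟩
        S ∎
        where open ≡-Reasoning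

      symbol-sum : ∑ B₀ (λ t → γₜ t * γₜ t) ≡ S
      symbol-sum = transfer column _ (λ _ _ → refl)

      defect-vanishes : ∑ B₀ (λ t → defect t * defect t) ≡ 0ℤ
      defect-vanishes = begin
        ∑ B₀ (λ t → defect t * defect t)
          ≡⟨ ∑-square-expand B₀ (λ t → αₜ t + βₜ t) γₜ ⟩
        ∑ B₀ (λ t → (αₜ t + βₜ t) * (αₜ t + βₜ t)) - + 2 * ∑ B₀ (λ t → (αₜ t + βₜ t) * γₜ t)
          + ∑ B₀ (λ t → γₜ t * γₜ t)
          ≡⟨ cong₂ (λ u v → u - + 2 * v + ∑ B₀ (λ t → γₜ t * γₜ t)) square-sum cross-sum ⟩
        S - + 2 * S + ∑ B₀ (λ t → γₜ t * γₜ t)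
          ≡⟨ cong (λ w → S - + 2 * S + w) symbol-sum ⟩
        S - + 2 * S + S
          ≡⟨ solve 1 (λ S → S :- con (+ 2) :* S :+ S := con 0ℤ) refl S ⟩
        0ℤ ∎
        where
          open ≡-Reasoning
          open +-*-Solver

module _ {X : Set a} {Pr : Pred (Triple X) q} (Pr? : Decidable Pr) where

  filter-disjoint : ∀ {L} → Disjoint (filter Pr? L) (filter (¬? ∘ Pr?) L)
  filter-disjoint {L} x∈yes x∈no =
    proj₂ (∈-filter⁻ (¬? ∘ Pr?) {xs = L} x∈no) (proj₂ (∈-filter⁻ Pr? {xs = L} x∈yes))

  filter-union : ∀ L → IsUnion L (filter Pr? L) (filter (¬? ∘ Pr?) L)
  filter-union L x = split , λ { (inj₁ x∈yes) → proj₁ (∈-filter⁻ Pr? x∈yes)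
                              ; (inj₂ x∈no)  → proj₁ (∈-filter⁻ (¬? ∘ Pr?) x∈no) }
    where
      split : x ∈ L → x ∈ filter Pr? L ⊎ x ∈ filter (¬? ∘ Pr?) L
      split x∈L with Pr? x
      ... | yes Pr-x = inj₁ (∈-filter⁺ Pr? x∈L Pr-x)
      ... | no ¬Pr-x = inj₂ (∈-filter⁺ (¬? ∘ Pr?) x∈L ¬Pr-x)

module _ {X : Set a} where

  InheritedByMates : TSet X → TSet X → Pred (Triple X) q → Set (a ⊔ q)
  InheritedByMates P Q Pr = ∀ ax {t x} → t ∈ P → t [ ax ≔ x ] ∈ Q → Pr t → Pr (t [ ax ≔ x ])

  restrict-bitrade : ∀ {W B} {Pr : Pred (Triple X) q} (Pr? : Decidable Pr) → IsBitrade W B →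
    InheritedByMates W B Pr → InheritedByMates B W Pr →
    ∀ {t₀} → t₀ ∈ W → Pr t₀ → IsBitrade (filter Pr? W) (filter Pr? B)
  restrict-bitrade {W = W} {B} {Pr} Pr? (plsW , plsB , _ , _ , mWB , mBW) W→B B→W {t₀} t₀∈W Pr-t₀
    with x₀ , _ , t₀[x₀]∈B , _ ← mates-along mWB row t₀∈W =
    restrict-pls plsW , restrict-pls plsB ,
    (t₀ , ∈-filter⁺ Pr? t₀∈W Pr-t₀) ,
    (t₀ [ row ≔ x₀ ] , ∈-filter⁺ Pr? t₀[x₀]∈B (W→B row t₀∈W t₀[x₀]∈B Pr-t₀)) ,
    mates-from-along (restrict-mates W→B (mates-along mWB)) ,
    mates-from-along (restrict-mates B→W (mates-along mBW))
    where
      restrict-pls : ∀ {L} → IsPLS L → IsPLS (filter Pr? L)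
      restrict-pls pls t∈L' t'∈L' = pls (proj₁ (∈-filter⁻ Pr? t∈L')) (proj₁ (∈-filter⁻ Pr? t'∈L'))

      restrict-mates : ∀ {P Q} → InheritedByMates P Q Pr → (∀ ax → MatesAlong ax P Q) →
                       ∀ ax → MatesAlong ax (filter Pr? P) (filter Pr? Q)
      restrict-mates inherit m ax t∈P' =
        let (t∈P , Pr-t) = ∈-filter⁻ Pr? t∈P'
            (x , x≢ , t[x]∈Q , unique) = m ax t∈P
        in x , x≢ , ∈-filter⁺ Pr? t[x]∈Q (inherit ax t∈P t[x]∈Q Pr-t) ,
           λ y y≢ t[y]∈Q' → unique y y≢ (proj₁ (∈-filter⁻ Pr? t[y]∈Q'))

  MateInvariant : {V : Set q} → TSet X → TSet X → (Triple X → V) → Set (a ⊔ q)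
  MateInvariant W B κ = ∀ ax {t x} → t ∈ W → t [ ax ≔ x ] ∈ B → κ t ≡ κ (t [ ax ≔ x ])

  -- Mate invariance is symmetric, since a triple is the mate of its own mate.
  mate-invariant-sym : ∀ {V : Set q} {W B} {κ : Triple X → V} → MateInvariant W B κ → MateInvariant B W κ
  mate-invariant-sym {κ = κ} inv ax {t} {x} t∈B t[x]∈W =
    sym (subst (λ u → κ (t [ ax ≔ x ]) ≡ κ u) (≔-restore t ax x)
               (inv ax t[x]∈W (subst (_∈ _) (sym (≔-restore t ax x)) t∈B)))

  inherited-value : ∀ {V : Set q} {P Q} {κ : Triple X → V} → MateInvariant P Q κ →
                    (Prop : Pred V q) → InheritedByMates P Q (Prop ∘ κ)
  inherited-value inv Prop ax t∈P t[x]∈Q = subst Prop (inv ax t∈P t[x]∈Q)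

  -- In a connected bitrade, a mate-invariant function (with values in a type with
  -- decidable equality) is constant on W: otherwise its level set through one
  -- triple and the complement would split the bitrade into two bitrades.
  mate-invariant-constant : ∀ {V : Set q} → DecidableEquality V → ∀ {W B} → IsConnectedBitrade W B →
    (κ : Triple X → V) → MateInvariant W B κ → ∀ {t t'} → t ∈ W → t' ∈ W → κ t ≡ κ t'
  mate-invariant-constant {V = V} _≟ᵥ_ {W} {B} (bitrade , connected) κ inv {t} {t'} t∈W t'∈W =
    decidable-stable (κ t ≟ᵥ κ t') λ κt≢κt' →
      connected (filter Same? W , filter Same? B , filter Other? W , filter Other? B ,
                 restrict (_≡ κ t) Same? t∈W refl , restrict (_≢ κ t) Other? t'∈W (κt≢κt' ∘ sym) ,
                 filter-disjoint Same? {W} , filter-union Same? W , filter-union Same? B)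
    where
      Same? : Decidable (λ u → κ u ≡ κ t)
      Same? u = κ u ≟ᵥ κ t

      Other? : Decidable (λ u → κ u ≢ κ t)
      Other? = ¬? ∘ Same?

      restrict : (Prop : Pred V _) (Prop? : Decidable (Prop ∘ κ)) → ∀ {t₀} → t₀ ∈ W → Prop (κ t₀) →
                 IsBitrade (filter Prop? W) (filter Prop? B)
      restrict Prop Prop? = restrict-bitrade Prop? bitrade
        (inherited-value inv Prop) (inherited-value (mate-invariant-sym inv) Prop)

-- In a connected bitrade, an additive integer labelling α r + β c = γ s of W has
-- constant row labels and constant column labels on W: by labelling-on-mates the
-- labelling also holds on B, so α of a row is unchanged when passing to a row mate
-- (and trivially when passing to a column or symbol mate), and likewise for β.
labelling-constant : {X : Set a} {W B : TSet X} → IsConnectedBitrade W B →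
  (α β γ : X → ℤ) → (∀ {r c s} → (r , c , s) ∈ W → α r + β c ≡ γ s) →
  ∀ {r c s r' c' s'} → (r , c , s) ∈ W → (r' , c' , s') ∈ W → α r ≡ α r' × β c ≡ β c'
labelling-constant {W = W} {B} connected-bitrade@((_ , _ , _ , _ , mWB , mBW) , _) α β γ on-W t∈W t'∈W =
  mate-invariant-constant _≟_ connected-bitrade (λ t → α (t at row)) row-invariant t∈W t'∈W ,
  mate-invariant-constant _≟_ connected-bitrade (λ t → β (t at column)) column-invariant t∈W t'∈W
  where
    on-B : ∀ {r c s} → (r , c , s) ∈ B → α r + β c ≡ γ s
    on-B = labelling-on-mates mWB mBW α β γ on-W

    row-invariant : MateInvariant W B (λ t → α (t at row))
    row-invariant row    {r , c , s} t∈W t[x]∈B =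
      ∙-cancelʳ ℤ+ (β c) _ _ (trans (on-W t∈W) (sym (on-B t[x]∈B)))
    row-invariant column _ _ = refl
    row-invariant symbol _ _ = refl

    column-invariant : MateInvariant W B (λ t → β (t at column))
    column-invariant row    _ _ = refl
    column-invariant column {r , c , s} t∈W t[x]∈B =
      ∙-cancelˡ ℤ+ (α r) _ _ (trans (on-W t∈W) (sym (on-B t[x]∈B)))
    column-invariant symbol _ _ = refl

module _ {c ℓ} (G : Group c ℓ) {X : Set a} where
  open Group G using (Carrier; _≈_; _∙_; _⁻¹; assoc; ∙-congˡ; ∙-congʳ)

  rowMap colMap symMap : ∀ {p} {H : Carrier → Set p} {P : TSet X} → EmbedsIn G H P → X → Carrier
  rowMap e = proj₁ e
  colMap e = proj₁ (proj₂ e)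
  symMap e = proj₁ (proj₂ (proj₂ e))

  restrict-embedding : ∀ {p} {H : Carrier → Set p} {P : TSet X} (e : EmbedsInGroup G P) →
    (∀ {r c s} → (r , c , s) ∈ P → H (rowMap e r) × H (colMap e c) × H (symMap e s)) →
    EmbedsIn G H P
  restrict-embedding (f , h , k , _ , rest) in-H = f , h , k , in-H , rest

  translate : ∀ {P : TSet X} → EmbedsInGroup G P → (a b : Carrier) → EmbedsInGroup G P
  translate (f , h , k , _ , inj-f , inj-h , inj-k , equation) a b =
    f′ , h′ , k′ , _ ,
    (λ t∈P t'∈P eq → inj-f t∈P t'∈P (∙-cancelʳ G (a ⁻¹) _ _ eq)) ,
    (λ t∈P t'∈P eq → inj-h t∈P t'∈P (∙-cancelˡ G a _ _ (∙-cancelʳ G (b ⁻¹) _ _ eq))) ,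
    (λ t∈P t'∈P eq → inj-k t∈P t'∈P (∙-cancelʳ G (b ⁻¹) _ _ eq)) ,
    equation′
    where
      f′ h′ k′ : X → Carrier
      f′ r = f r ∙ a ⁻¹
      h′ c = (a ∙ h c) ∙ b ⁻¹
      k′ s = k s ∙ b ⁻¹

      equation′ : ∀ {r c s} → (r , c , s) ∈ _ → f′ r ∙ h′ c ≈ k′ s
      equation′ {r} {c} {s} t∈P = begin
        (f r ∙ a ⁻¹) ∙ ((a ∙ h c) ∙ b ⁻¹)  ≈⟨ assoc _ _ _ ⟨
        ((f r ∙ a ⁻¹) ∙ (a ∙ h c)) ∙ b ⁻¹  ≈⟨ ∙-congʳ (assoc _ _ _) ⟩
        (f r ∙ (a ⁻¹ ∙ (a ∙ h c))) ∙ b ⁻¹  ≈⟨ ∙-congʳ (∙-congˡ (\\-leftDividesʳ G a (h c))) ⟩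
        (f r ∙ h c) ∙ b ⁻¹                 ≈⟨ ∙-congʳ (equation t∈P) ⟩
        k s ∙ b ⁻¹                         ∎
        where open SetoidReasoning (Group.setoid G)

-- The theorem: translate the given embedding so that the base triple (r₀, c₀, s₀)
-- of W is sent to (1, 1, 1).  The labels α = φ ∘ f, β = φ ∘ h, γ = φ ∘ k form an
-- additive labelling of W, so α and β are constant on W; hence each translated
-- label has φ-value zero.
lemma3p12 : ∀ {a c ℓ} {X : Set a} (G : Group c ℓ) (φ : Group.Carrier G → ℤ) →
    IsHomToℤ G φ →
    (W B : TSet X) → IsConnectedBitrade W B →
    EmbedsInGroup G W →
    EmbedsIn G (Ker {G = G} φ) W
lemma3p12 G φ hom W B connected-bitrade@((_ , _ , ((r₀ , _ , s₀) , t₀∈W) , _) , _)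
          e@(f , h , k , _ , _ , _ , _ , equation) =
  restrict-embedding G {H = Ker {G = G} φ} (translate G e (f r₀) (k s₀)) in-kernel
  where
    open Group G using (_∙_; _⁻¹)
    open GroupMorphisms.IsGroupHomomorphism hom using (homo; ⁻¹-homo; ⟦⟧-cong)

    labelling : ∀ {r c s} → (r , c , s) ∈ W → φ (f r) + φ (h c) ≡ φ (k s)
    labelling t∈W = trans (sym (homo _ _)) (⟦⟧-cong (equation t∈W))

    quotient-in-kernel : ∀ {x y} → φ x ≡ φ y → φ (x ∙ y ⁻¹) ≡ 0ℤ
    quotient-in-kernel {x} {y} eq =
      trans (homo x (y ⁻¹)) (trans (cong (λ z → φ x + z) (⁻¹-homo y)) (ℤP.i≡j⇒i-j≡0 eq))

    in-kernel : ∀ {r c s} → (r , c , s) ∈ W →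
      φ (f r ∙ f r₀ ⁻¹) ≡ 0ℤ × φ ((f r₀ ∙ h c) ∙ k s₀ ⁻¹) ≡ 0ℤ × φ (k s ∙ k s₀ ⁻¹) ≡ 0ℤ
    in-kernel t∈W =
      let (same-α , same-β) = labelling-constant connected-bitrade _ _ _ labelling t∈W t₀∈W in
      quotient-in-kernel same-α ,
      quotient-in-kernel (trans (homo _ _) (trans (cong (λ z → φ (f r₀) + z) same-β) (labelling t₀∈W))) ,
      quotient-in-kernel (trans (sym (labelling t∈W)) (trans (cong₂ _+_ same-α same-β) (labelling t₀∈W)))
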